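{- Let $\mathcal{P}=\mathcal{P}(\mathcal{F})$ be a $k$-local property of $[n]^d$-arrays over $\Sigma$, let $A$ be an $[n]^d$-array over $\Sigma$ that is $\varepsilon$-far from $\mathcal{P}$, and let $G$ be an $(n,d,k,w)$-grid, where $w\ge k$. Then at least one of the following holds: (1) there exists a $(\mathcal{P},A)$-unrepairable $G$-block; (2) for at least an $\varepsilon$-fraction of the $G$-blocks $B$, $A$ contains an $\mathcal{F}$-copy in $\overline{B}$.
   Context: Arrays: an $[n]^d$-array is a map $A:[n]^d\to\Sigma$. $\mathcal{P}(\mathcal{F})$ is $k$-local: $\mathcal{F}$ is a family of $[k]^d$-arrays and $A$ satisfies $\mathcal{P}$ iff no consecutive $[k]^d$ subarray of $A$ (i.e. $S(j)=A(a+j-\mathbf 1)$ for $j\in[k]^d$, some $a\in[n-k+1]^d$) lies in $\mathcal{F}$; such a subarray lying in $\mathcal{F}$ is an $\mathcal{F}$-copy, and it is "in" a set $X$ if all its entries lie in $X$. $A$ is $\varepsilon$-far from $\mathcal{P}$ if at least $\varepsilon n^d$ entries must be changed to make it satisfy $\mathcal{P}$. Grid: for an interval $I\subseteq[n]$, $I[\colon\ell]$ is the set of its $\ell$ smallest elements; an $(n,w)$-interval partition is a partition of $[n]$ into increasingly ordered intervals $I_1,\dots,I_t$ of sizes $w$ or $w+1$; for $2\le k\le w$, the $(n,d,k,w)$-grid induced by it is $G=\{x\in[n]^d:\exists i,\ x_i\in\bigcup_j I_j[\colon k-1]\}$. A $G$-block is a connected component of $[n]^d\setminus G$ under the adjacency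 $\sum_i|x_i-y_i|=1$. Its closure is $\overline{B}=\{x:\exists y\in B,\ |x_i-y_i|<k\ \forall i\}$ and its boundary is $\partial B=\overline{B}\setminus B$. A $G$-block $B$ is $(\mathcal{P},A)$-unrepairable if every $[n]^d$-array $A'$ over $\Sigma$ with $A'(x)=A(x)$ for all $x\in\partial B$ (including $A'=A$) contains an $\mathcal{F}$-copy in $\overline{B}$; otherwise it is $(\mathcal{P},A)$-repairable. -}

module Defs where

open import Data.Nat using (ℕ; zero; suc; _+_; _*_; _∸_; _^_; _≤_; _<_; ∣_-_∣)
open import Data.Fin using (Fin; toℕ)
open import Data.Vec using (Vec; lookup; zipWith; sum)
open import Data.List using (List; []; _∷_; length)
open import Data.List.Relation.Unary.All using (All)
open import Data.List.Relation.Unary.Any using (Any)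
open import Data.List.Relation.Unary.AllPairs using (AllPairs)
open import Data.List.Relation.Binary.Sublist.Propositional using (_⊆_)
open import Data.List.Membership.Propositional using (_∈_)
open import Data.Product using (Σ; _×_; ∃; ∃-syntax)
open import Data.Sum using (_⊎_)
open import Data.Empty using (⊥)
open import Data.Unit using (⊤)
open import Relation.Nullary using (¬_)
open import Relation.Binary.PropositionalEquality using (_≡_)
open import Relation.Binary.Construct.Closure.ReflexiveTransitive using (Star)

-- Conventions: coordinates are 0-based, i.e. [n] is modelled by Fin n.
-- The alphabet Σ is the finite set Fin s.

Pos : ℕ → ℕ → Set
Pos n d = Vec (Fin n) d

Array : ℕ → ℕ → Set → Set
Array n d Al = Pos n d → Al

-- A k-local family F is a (finite) list of [k]^d-arrays.
-- S lies in F iff it agrees pointwise with some member of the list.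
_∈F_ : ∀ {k d Al} → Array k d Al → List (Array k d Al) → Set
S ∈F F = Any (λ P → ∀ j → S j ≡ P j) F

IsShift : ∀ {n k d} → Vec ℕ d → Pos k d → Pos n d → Set
IsShift a j x = ∀ i → toℕ (lookup x i) ≡ lookup a i + toℕ (lookup j i)

-- The consecutive [k]^d subarray of A at offset a (a ∈ [n-k+1]^d),
-- given as the relation "S j = A (a + j)".
SubarrayAt : ∀ {n k d Al} → Array n d Al → (a : Vec ℕ d) → Array k d Al → Set
SubarrayAt {n} {k} {d} A a S = ∀ (j : Pos k d) (x : Pos n d) → IsShift a j x → S j ≡ A x

HasCopyIn : ∀ {n k d Al} → List (Array k d Al) → Array n d Al → (Pos n d → Set) → Set
HasCopyIn {n} {k} {d} {Al} F A X =
  Σ (Vec ℕ d) λ a →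
    (∀ i → lookup a i + k ≤ n) ×
    Σ (Array k d Al) (λ S → SubarrayAt A a S × S ∈F F ×
      (∀ (j : Pos k d) (x : Pos n d) → IsShift a j x → X x))

Satisfies : ∀ {n k d Al} → List (Array k d Al) → Array n d Al → Set
Satisfies F A = ¬ HasCopyIn F A (λ _ → ⊤)

-- A is ε-far from P(F), with ε = p / q: whenever A' satisfies P and the list L
-- covers all positions where A and A' differ, |L| ≥ ε n^d.
Far : ∀ {n k d Al} → List (Array k d Al) → Array n d Al → (p q : ℕ) → Set
Far {n} {k} {d} {Al} F A p q =
  ∀ (A' : Array n d Al) → Satisfies F A' →
  ∀ (L : List (Pos n d)) → (∀ x → A x ≡ A' x ⊎ x ∈ L) →
  p * n ^ d ≤ q * length L

-- (n,w)-interval partition, given by the list of interval lengths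
-- (intervals are consecutive, increasingly ordered, starting at 0).
IsIntervalPartition : ℕ → ℕ → List ℕ → Set
IsIntervalPartition n w ls = All (λ l → l ≡ w ⊎ l ≡ suc w) ls × lsum ls ≡ n
  where open import Data.Nat.ListAction renaming (sum to lsum)

-- c ∈ ⋃_j I_j[:k-1], where the first interval of ls starts at off.
InLines : ℕ → List ℕ → ℕ → ℕ → Set
InLines k []       off c = ⊥
InLines k (l ∷ ls) off c = (off ≤ c × c < off + (k ∸ 1)) ⊎ InLines k ls (off + l) c

Grid : ∀ {n d} → ℕ → List ℕ → Pos n d → Set
Grid k ls x = ∃[ i ] InLines k ls 0 (toℕ (lookup x i))

Adj : ∀ {n d} → Pos n d → Pos n d → Set
Adj x y = sum (zipWith (λ a b → ∣ toℕ a - toℕ b ∣) x y) ≡ 1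

Step : ∀ {n d} → (Pos n d → Set) → Pos n d → Pos n d → Set
Step G x y = ¬ G x × ¬ G y × Adj x y

Block : ∀ {n d} → (Pos n d → Set) → Pos n d → Pos n d → Set
Block G r x = ¬ G r × Star (Step G) r x

Closure : ∀ {n d} → ℕ → (Pos n d → Set) → Pos n d → Set
Closure {n} {d} k B x = Σ (Pos n d) λ y → B y × (∀ i → ∣ toℕ (lookup x i) - toℕ (lookup y i) ∣ < k)

Boundary : ∀ {n d} → ℕ → (Pos n d → Set) → Pos n d → Set
Boundary k B x = Closure k B x × ¬ B x

Unrepairable : ∀ {n k d Al} → List (Array k d Al) → Array n d Al → (Pos n d → Set) → Set
Unrepairable {n} {k} {d} {Al} F A B =
  ∀ (A' : Array n d Al) → (∀ x → Boundary k B x → A' x ≡ A x) → HasCopyIn F A' (Closure k B)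

-- The number of G-blocks is then length R.
BlockReps : ∀ {n d} → (Pos n d → Set) → List (Pos n d) → Set
BlockReps {n} {d} G R =
  All (λ r → ¬ G r) R ×
  (∀ (x : Pos n d) → ¬ G x → Any (λ r → Block G r x) R) ×
  AllPairs (λ r r' → ¬ Block G r r') R

-- Every interval has length at least w ≥ k, so two off-line coordinates at distance < k lie in a
-- common interval, the off-line points of an interval form a contiguous range, and any k consecutive
-- coordinates contain an off-line one. Hence the G-blocks are exactly the boxes
-- ∏ᵢ (I_{jᵢ} ∖ I_{jᵢ}[:k-1]), of at most w^d points each and at most (n/w)^d in number, and every
-- consecutive [k]^d window lies in the closure of a single block. If no block is unrepairable,
-- repair A inside every block whose closure contains an F-copy and glue the repairs: each window
-- sees a single repaired closure, so the result satisfies P, and it differs from A only inside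
-- those dirty blocks. As A is ε-far, ε n^d ≤ #dirty · w^d, while #blocks · w^d ≤ n^d.

module Submission where

open import Defs
open import Data.Nat using (ℕ; zero; suc; _+_; _*_; _∸_; _^_; _≤_; _<_; z≤n; s≤s; _≤?_; _<?_; NonZero; >-nonZero; ∣_-_∣)
open import Data.Nat.Properties
open import Algebra.Properties.CommutativeSemigroup *-commutativeSemigroup using (interchange)
open import Data.Nat.ListAction using (sum)
open import Data.Fin using (Fin; toℕ; fromℕ<; combine) renaming (zero to fzero; suc to fsuc; _≟_ to _≟ᶠ_)
open import Data.Fin.Properties using (any?; all?; pigeonhole; combine-injective; toℕ-injective; toℕ-fromℕ<; toℕ<n)
open import Data.Vec using (Vec; []; _∷_; lookup; tabulate; zipWith; replicate)
import Data.Vec as Vec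
open import Data.Vec.Properties using (tabulate∘lookup; tabulate-cong; lookup∘tabulate; lookup-map; lookup-replicate)
open import Data.List using (List; []; _∷_; [_]; length; map; _++_; upTo; allFin; filter; concatMap; cartesianProductWith)
import Data.List as List
open import Data.List.Properties using (length-map; length-++; length-upTo)
open import Data.List.Relation.Unary.All as All using (All; []; _∷_)
open import Data.List.Relation.Unary.All.Properties using (all-filter)
open import Data.List.Relation.Unary.Any as Any using (Any; here; there)
open import Data.List.Relation.Unary.Any.Properties using (lookup-index)
open import Data.List.Relation.Unary.AllPairs using (AllPairs; []; _∷_)
open import Data.List.Relation.Binary.Sublist.Propositional using (_⊆_)
open import Data.List.Relation.Binary.Sublist.Propositional.Properties using (filter-⊆)
open import Data.List.Membership.Propositional using (_∈_; find; lose)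
open import Data.List.Membership.Propositional.Properties
  using (∈-cartesianProductWith⁺; ∈-lookup; ∈-upTo⁺; ∈-map⁺; ∈-allFin; ∈-filter⁺; ∈-concat⁺′)
open import Data.Product using (Σ; ∃; ∃-syntax; _×_; _,_; proj₁; proj₂)
open import Data.Sum using (_⊎_; inj₁; inj₂)
open import Function using (id; _∘_)
open import Relation.Nullary using (¬_; Dec; yes; no; contradiction)
open import Relation.Nullary.Decidable using (_×-dec_; _⊎-dec_; ¬?; map′; decidable-stable)
open import Relation.Binary.PropositionalEquality using (_≡_; refl; sym; trans; cong; cong₂; subst; subst₂; module ≡-Reasoning)
open import Relation.Binary.Construct.Closure.ReflexiveTransitive using (Star; ε; _◅_; _◅◅_; gmap; reverse)

^-distribʳ-* : ∀ m n o → (m * n) ^ o ≡ m ^ o * n ^ o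
^-distribʳ-* m n zero    = refl
^-distribʳ-* m n (suc o) = begin
  m * n * (m * n) ^ o      ≡⟨ cong (m * n *_) (^-distribʳ-* m n o) ⟩
  m * n * (m ^ o * n ^ o)  ≡⟨ interchange m n (m ^ o) (n ^ o) ⟩
  m * m ^ o * (n * n ^ o)  ∎
  where open ≡-Reasoning

<+⇒∸< : ∀ {l c m} → l ≤ c → c < l + m → c ∸ l < m
<+⇒∸< {l} {c} {m} l≤c c<l+m = +-cancelˡ-< l (c ∸ l) m (subst (_< l + m) (sym (m+[n∸m]≡n l≤c)) c<l+m)

∣-∣<⇒≤+ : ∀ {a b k} → a ≤ b → ∣ a - b ∣ < k → b ≤ a + (k ∸ 1)
∣-∣<⇒≤+ {a} {b} {k} a≤b ∣a-b∣<k =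
  ≤-trans (m≤n+m∸n b a) (+-monoʳ-≤ a (∸-monoˡ-≤ 1 (subst (_< k) (m≤n⇒∣m-n∣≡n∸m a≤b) ∣a-b∣<k)))

∣-∣<-window : ∀ {a u v k} → a ≤ u → u < a + k → a ≤ v → v < a + k → ∣ u - v ∣ < k
∣-∣<-window {a} {u} {v} {k} a≤u u<a+k a≤v v<a+k with ≤-total u v
... | inj₁ u≤v = subst (_< k) (sym (m≤n⇒∣m-n∣≡n∸m u≤v)) (≤-<-trans (∸-monoʳ-≤ v a≤u) (<+⇒∸< a≤v v<a+k))
... | inj₂ v≤u = subst (_< k) (sym (m≤n⇒∣n-m∣≡n∸m v≤u)) (≤-<-trans (∸-monoʳ-≤ u a≤v) (<+⇒∸< a≤u u<a+k))

length*≤sum : ∀ w ls → All (w ≤_) ls → length ls * w ≤ sum ls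
length*≤sum w [] [] = z≤n
length*≤sum w (l ∷ ls) (w≤l ∷ w≤ls) = +-mono-≤ w≤l (length*≤sum w ls w≤ls)

lookup-ext : ∀ {A : Set} {d} {x y : Vec A d} → (∀ i → lookup x i ≡ lookup y i) → x ≡ y
lookup-ext {x = x} {y} eq = begin
  x                 ≡⟨ tabulate∘lookup x ⟨
  tabulate (lookup x) ≡⟨ tabulate-cong eq ⟩
  tabulate (lookup y) ≡⟨ tabulate∘lookup y ⟩
  y                 ∎
  where open ≡-Reasoning

module _ {n : ℕ} where

  anyVec? : ∀ {d} {P : Vec (Fin n) d → Set} → (∀ v → Dec (P v)) → Dec (∃ P)
  anyVec? {zero}  P? = map′ ([] ,_) (λ { ([] , p) → p }) (P? [])
  anyVec? {suc d} P? = map′ (λ (a , v , p) → a ∷ v , p) (λ { (a ∷ v , p) → a , v , p })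
                            (any? λ a → anyVec? λ v → P? (a ∷ v))

  allVec? : ∀ {d} {P : Vec (Fin n) d → Set} → (∀ v → Dec (P v)) → Dec (∀ v → P v)
  allVec? {zero}  P? = map′ (λ { p [] → p }) (λ p → p []) (P? [])
  allVec? {suc d} P? = map′ (λ { p (a ∷ v) → p a v }) (λ p a v → p (a ∷ v))
                            (all? λ a → allVec? λ v → P? (a ∷ v))

length-cartesianProductWith : ∀ {A B C : Set} (f : A → B → C) xs ys →
                              length (cartesianProductWith f xs ys) ≡ length xs * length ys
length-cartesianProductWith f []       ys = refl
length-cartesianProductWith f (x ∷ xs) ys = begin
  length (map (f x) ys ++ cartesianProductWith f xs ys)          ≡⟨ length-++ (map (f x) ys) ⟩
  length (map (f x) ys) + length (cartesianProductWith f xs ys)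
    ≡⟨ cong₂ _+_ (length-map (f x) ys) (length-cartesianProductWith f xs ys) ⟩
  length ys + length xs * length ys                              ∎
  where open ≡-Reasoning

choices : ∀ {A : Set} {d} → Vec (List A) d → List (Vec A d)
choices []         = [ [] ]
choices (xs ∷ xss) = cartesianProductWith _∷_ xs (choices xss)

∈-choices : ∀ {A : Set} {d} (xss : Vec (List A) d) {v : Vec A d} → (∀ i → lookup v i ∈ lookup xss i) → v ∈ choices xss
∈-choices []         {[]}    _   = here refl
∈-choices (xs ∷ xss) {a ∷ v} mem = ∈-cartesianProductWith⁺ _∷_ (mem fzero) (∈-choices xss (λ i → mem (fsuc i)))

length-choices≤ : ∀ {A : Set} {d} w (xss : Vec (List A) d) → (∀ i → length (lookup xss i) ≤ w) →
                  length (choices xss) ≤ w ^ d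
length-choices≤ w []         _   = ≤-refl
length-choices≤ {d = suc d} w (xs ∷ xss) len≤ =
  subst (_≤ w * w ^ d) (sym (length-cartesianProductWith _∷_ xs (choices xss)))
    (*-mono-≤ (len≤ fzero) (length-choices≤ w xss (λ i → len≤ (fsuc i))))

finsBelow : (n : ℕ) → List ℕ → List (Fin n)
finsBelow n []       = []
finsBelow n (m ∷ ms) with m <? n
... | yes m<n = fromℕ< m<n ∷ finsBelow n ms
... | no  _   = finsBelow n ms

length-finsBelow : ∀ n ms → length (finsBelow n ms) ≤ length ms
length-finsBelow n []       = z≤n
length-finsBelow n (m ∷ ms) with m <? n
... | yes _ = s≤s (length-finsBelow n ms)
... | no  _ = m≤n⇒m≤1+n (length-finsBelow n ms)

∈-finsBelow : ∀ {n} {c : Fin n} ms → toℕ c ∈ ms → c ∈ finsBelow n ms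
∈-finsBelow {n} {c} (m ∷ ms) (here c≡m) with m <? n
... | yes m<n = here (toℕ-injective (trans c≡m (sym (toℕ-fromℕ< m<n))))
... | no  m≮n = contradiction (subst (_< n) c≡m (toℕ<n c)) m≮n
∈-finsBelow {n} (m ∷ ms) (there c∈ms) with m <? n
... | yes _ = there (∈-finsBelow ms c∈ms)
... | no  _ = ∈-finsBelow ms c∈ms

length-concatMap≤ : ∀ {A B : Set} {m} (f : A → List B) → (∀ x → length (f x) ≤ m) →
                    ∀ xs → length (concatMap f xs) ≤ length xs * m
length-concatMap≤ f len≤ []       = z≤n
length-concatMap≤ f len≤ (x ∷ xs) = subst (_≤ _) (sym (length-++ (f x))) (+-mono-≤ (len≤ x) (length-concatMap≤ f len≤ xs))

encode : ∀ {t d} → Vec (Fin t) d → Fin (t ^ d)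
encode []      = fzero
encode (a ∷ v) = combine a (encode v)

encode-injective : ∀ {t d} (u v : Vec (Fin t) d) → encode u ≡ encode v → u ≡ v
encode-injective []      []      _  = refl
encode-injective (a ∷ u) (b ∷ v) eq with combine-injective a (encode u) b (encode v) eq
... | refl , eq′ = cong (a ∷_) (encode-injective u v eq′)

AllPairs-lookup : ∀ {A : Set} {R : A → A → Set} {xs : List A} → AllPairs R xs →
                  ∀ i j → toℕ i < toℕ j → R (List.lookup xs i) (List.lookup xs j)
AllPairs-lookup (Rx ∷ _)    fzero    (fsuc j) _         = All.lookup Rx (∈-lookup j)
AllPairs-lookup (_ ∷ pairs) (fsuc i) (fsuc j) (s≤s i<j) = AllPairs-lookup pairs i j i<j

AllPairs-length≤ : ∀ {A : Set} {R : A → A → Set} {m} {xs : List A} (f : A → Fin m) →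
                   (∀ {x y} → x ∈ xs → y ∈ xs → f x ≡ f y → ¬ R x y) → AllPairs R xs → length xs ≤ m
AllPairs-length≤ {m = m} {xs} f collision pairs with length xs ≤? m
... | yes len≤m = len≤m
... | no  len≰m =
  let (i , j , i<j , same) = pigeonhole (≰⇒> len≰m) (λ i → f (List.lookup xs i))
  in contradiction (AllPairs-lookup pairs i j i<j) (collision (∈-lookup i) (∈-lookup j) same)

module _ {n : ℕ} where

  ℓ₁ : ∀ {d} → Pos n d → Pos n d → ℕ
  ℓ₁ x y = Vec.sum (zipWith (λ a b → ∣ toℕ a - toℕ b ∣) x y)

  ℓ₁-self : ∀ {d} (x : Pos n d) → ℓ₁ x x ≡ 0
  ℓ₁-self []      = refl
  ℓ₁-self (a ∷ x) = cong₂ _+_ (∣n-n∣≡0 (toℕ a)) (ℓ₁-self x)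

  ℓ₁-comm : ∀ {d} (x y : Pos n d) → ℓ₁ x y ≡ ℓ₁ y x
  ℓ₁-comm []      []      = refl
  ℓ₁-comm (a ∷ x) (b ∷ y) = cong₂ _+_ (∣-∣-comm (toℕ a) (toℕ b)) (ℓ₁-comm x y)

  ∣-∣≤ℓ₁ : ∀ {d} (x y : Pos n d) i → ∣ toℕ (lookup x i) - toℕ (lookup y i) ∣ ≤ ℓ₁ x y
  ∣-∣≤ℓ₁ (a ∷ x) (b ∷ y) fzero    = m≤m+n _ _
  ∣-∣≤ℓ₁ (a ∷ x) (b ∷ y) (fsuc i) = ≤-trans (∣-∣≤ℓ₁ x y i) (m≤n+m _ _)

  Adj-sym : ∀ {d} (x y : Pos n d) → Adj x y → Adj y x
  Adj-sym x y adj = trans (ℓ₁-comm y x) adj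

  Adj-∷ : ∀ {d} (h : Fin n) (x y : Pos n d) → Adj x y → Adj (h ∷ x) (h ∷ y)
  Adj-∷ h x y adj = cong₂ _+_ (∣n-n∣≡0 (toℕ h)) adj

  Adj-suc : ∀ {d} {a b : Fin n} (t : Pos n d) → toℕ b ≡ suc (toℕ a) → Adj (a ∷ t) (b ∷ t)
  Adj-suc {a = a} t b≡1+a =
    cong₂ _+_ (trans (cong (∣ toℕ a -_∣) (trans b≡1+a (+-comm 1 (toℕ a)))) (∣m-m+n∣≡n (toℕ a) 1)) (ℓ₁-self t)

-- Grid lines in one coordinate

module Lines (k : ℕ) where

  OffLines : List ℕ → ℕ → Set
  OffLines ls c = ¬ InLines k ls 0 c

  inLines? : ∀ ls off c → Dec (InLines k ls off c)
  inLines? []       off c = no λ ()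
  inLines? (l ∷ ls) off c = ((off ≤? c) ×-dec (c <? off + (k ∸ 1))) ⊎-dec inLines? ls (off + l) c

  inLines⇒off≤ : ∀ ls off c → InLines k ls off c → off ≤ c
  inLines⇒off≤ (l ∷ ls) off c (inj₁ (off≤c , _)) = off≤c
  inLines⇒off≤ (l ∷ ls) off c (inj₂ q)           = ≤-trans (m≤m+n off l) (inLines⇒off≤ ls (off + l) c q)

  inLines-+⁻ : ∀ m ls off c → InLines k ls (m + off) (m + c) → InLines k ls off c
  inLines-+⁻ m (l ∷ ls) off c (inj₁ (p , q)) =
    inj₁ (+-cancelˡ-≤ m off c p , +-cancelˡ-< m c (off + (k ∸ 1)) (subst (m + c <_) (+-assoc m off (k ∸ 1)) q))
  inLines-+⁻ m (l ∷ ls) off c (inj₂ q) =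
    inj₂ (inLines-+⁻ m ls (off + l) c (subst (λ o → InLines k ls o (m + c)) (+-assoc m off l) q))

  inLines-+⁺ : ∀ m ls off c → InLines k ls off c → InLines k ls (m + off) (m + c)
  inLines-+⁺ m (l ∷ ls) off c (inj₁ (p , q)) =
    inj₁ (+-monoʳ-≤ m p , subst (m + c <_) (sym (+-assoc m off (k ∸ 1))) (+-monoʳ-< m q))
  inLines-+⁺ m (l ∷ ls) off c (inj₂ q) =
    inj₂ (subst (λ o → InLines k ls o (m + c)) (sym (+-assoc m off l)) (inLines-+⁺ m ls (off + l) c q))

  inLines-∷⁻ : ∀ l ls c → l ≤ c → k ∸ 1 ≤ l → InLines k (l ∷ ls) 0 c → InLines k ls 0 (c ∸ l)
  inLines-∷⁻ l ls c l≤c _     (inj₂ q)          =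
    inLines-+⁻ l ls 0 (c ∸ l) (subst₂ (InLines k ls) (sym (+-identityʳ l)) (sym (m+[n∸m]≡n l≤c)) q)
  inLines-∷⁻ l ls c l≤c k-1≤l (inj₁ (_ , c<k-1)) = contradiction (≤-trans k-1≤l l≤c) (<⇒≱ c<k-1)

  inLines-∷⁺ : ∀ l ls c → l ≤ c → InLines k ls 0 (c ∸ l) → InLines k (l ∷ ls) 0 c
  inLines-∷⁺ l ls c l≤c q =
    inj₂ (subst₂ (InLines k ls) (+-identityʳ l) (m+[n∸m]≡n l≤c) (inLines-+⁺ l ls 0 (c ∸ l) q))

  inLines-∷-head : ∀ l ls c → c < l → InLines k (l ∷ ls) 0 c → c < k ∸ 1
  inLines-∷-head l ls c c<l (inj₁ (_ , c<k-1)) = c<k-1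
  inLines-∷-head l ls c c<l (inj₂ q)           = contradiction (inLines⇒off≤ ls l c q) (<⇒≱ c<l)

  inLines-first : ∀ ls c → c < sum ls → c < k ∸ 1 → InLines k ls 0 c
  inLines-first (l ∷ ls) c _ c<k-1 = inj₁ (z≤n , c<k-1)

  offLines-∷⁻ : ∀ l ls c → l ≤ c → OffLines (l ∷ ls) c → OffLines ls (c ∸ l)
  offLines-∷⁻ l ls c l≤c off q = off (inLines-∷⁺ l ls c l≤c q)

  interval : List ℕ → ℕ → ℕ
  interval []       c = 0
  interval (l ∷ ls) c with c <? l
  ... | yes _ = 0
  ... | no  _ = suc (interval ls (c ∸ l))

  interval-near : ∀ ls a b → a ≤ b → b ≤ a + (k ∸ 1) → b < sum ls →
                  OffLines ls a → OffLines ls b → interval ls a ≡ interval ls b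
  interval-near []       a b _   _     _     _    _    = refl
  interval-near (l ∷ ls) a b a≤b b≤a+ b<sum offa offb with a <? l | b <? l
  ... | yes _   | yes _   = refl
  ... | yes a<l | no  b≮l =
    contradiction (inLines-∷⁺ l ls b l≤b (inLines-first ls (b ∸ l) (<+⇒∸< l≤b b<sum) (<+⇒∸< l≤b b<l+k-1))) offb
    where
    l≤b = ≮⇒≥ b≮l
    b<l+k-1 : b < l + (k ∸ 1)
    b<l+k-1 = ≤-<-trans b≤a+ (+-monoˡ-< (k ∸ 1) a<l)
  ... | no  a≮l | yes b<l = contradiction (≤-trans (≮⇒≥ a≮l) a≤b) (<⇒≱ b<l)
  ... | no  a≮l | no  b≮l =
    cong suc (interval-near ls (a ∸ l) (b ∸ l) (∸-monoˡ-≤ l a≤b) b-l≤ (<+⇒∸< l≤b b<sum)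
               (offLines-∷⁻ l ls a l≤a offa) (offLines-∷⁻ l ls b l≤b offb))
    where
    l≤a = ≮⇒≥ a≮l
    l≤b = ≮⇒≥ b≮l
    b-l≤ : b ∸ l ≤ a ∸ l + (k ∸ 1)
    b-l≤ = subst (b ∸ l ≤_) (+-∸-comm (k ∸ 1) l≤a) (∸-monoˡ-≤ l b≤a+)

  interval-convex : ∀ ls → All (k ≤_) ls → ∀ a m b → a ≤ m → m ≤ b →
                    OffLines ls a → OffLines ls b → interval ls a ≡ interval ls b →
                    OffLines ls m × interval ls m ≡ interval ls a
  interval-convex []       _              a m b _   _   _    _    _  = (λ ()) , refl
  interval-convex (l ∷ ls) (k≤l ∷ k≤ls) a m b a≤m m≤b offa offb same with a <? l | m <? l | b <? l
  ... | yes _   | yes m<l | _       = offm , refl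
    where
    offm : OffLines (l ∷ ls) m
    offm q = offa (inj₁ (z≤n , ≤-<-trans a≤m (inLines-∷-head l ls m m<l q)))
  ... | yes _   | no  m≮l | yes b<l = contradiction (≤-trans (≮⇒≥ m≮l) m≤b) (<⇒≱ b<l)
  ... | yes _   | no  _   | no  _   = contradiction same 0≢1+n
  ... | no  a≮l | yes m<l | _       = contradiction (≤-trans (≮⇒≥ a≮l) a≤m) (<⇒≱ m<l)
  ... | no  _   | no  m≮l | yes b<l = contradiction (≤-trans (≮⇒≥ m≮l) m≤b) (<⇒≱ b<l)
  ... | no  a≮l | no  m≮l | no  b≮l =
    (λ q → proj₁ rec (inLines-∷⁻ l ls m (≮⇒≥ m≮l) (≤-trans (m∸n≤m k 1) k≤l) q)) , cong suc (proj₂ rec)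
    where
    rec = interval-convex ls k≤ls (a ∸ l) (m ∸ l) (b ∸ l) (∸-monoˡ-≤ l a≤m) (∸-monoˡ-≤ l m≤b)
            (offLines-∷⁻ l ls a (≮⇒≥ a≮l) offa) (offLines-∷⁻ l ls b (≮⇒≥ b≮l) offb) (suc-injective same)

  offLines-in-window : ∀ ls → All (k ≤_) ls → 1 ≤ k → ∀ a → a + k ≤ sum ls →
                       Σ ℕ λ c → a ≤ c × c < a + k × OffLines ls c
  offLines-in-window []       _              1≤k a a+k≤0 with ≤-trans (≤-trans 1≤k (m≤n+m k a)) a+k≤0
  ... | ()
  offLines-in-window (l ∷ ls) (k≤l ∷ k≤ls) 1≤k a a+k≤ with a <? l | k ∸ 1 ≤? a
  ... | yes a<l | yes k-1≤a = a , ≤-refl , m<m+n a 1≤k ,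
                               λ q → contradiction (inLines-∷-head l ls a a<l q) (≤⇒≯ k-1≤a)
  ... | yes _   | no  k-1≰a = k ∸ 1 , <⇒≤ (≰⇒> k-1≰a) , <-≤-trans k-1<k (m≤n+m k a) ,
                               λ q → <-irrefl refl (inLines-∷-head l ls (k ∸ 1) (<-≤-trans k-1<k k≤l) q)
    where
    k-1<k : k ∸ 1 < k
    k-1<k = subst (k ∸ 1 <_) (m+[n∸m]≡n 1≤k) (n<1+n (k ∸ 1))
  ... | no  a≮l | _ =
    let (c , a-l≤c , c< , offc) = offLines-in-window ls k≤ls 1≤k (a ∸ l) a-l+k≤ in
    l + c , subst (_≤ l + c) (m+[n∸m]≡n l≤a) (+-monoʳ-≤ l a-l≤c) ,
    subst (l + c <_) (trans (sym (+-assoc l (a ∸ l) k)) (cong (_+ k) (m+[n∸m]≡n l≤a))) (+-monoʳ-< l c<) ,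
    λ q → offc (subst (InLines k ls 0) (m+n∸m≡n l c)
                  (inLines-∷⁻ l ls (l + c) (m≤m+n l c) (≤-trans (m∸n≤m k 1) k≤l) q))
    where
    l≤a = ≮⇒≥ a≮l
    a-l+k≤ : a ∸ l + k ≤ sum ls
    a-l+k≤ = +-cancelˡ-≤ l (a ∸ l + k) (sum ls)
               (subst (_≤ l + sum ls) (trans (cong (_+ k) (sym (m+[n∸m]≡n l≤a))) (+-assoc l (a ∸ l) k)) a+k≤)

  interval<length : ∀ ls c → c < sum ls → interval ls c < length ls
  interval<length (l ∷ ls) c c<sum with c <? l
  ... | yes _   = s≤s z≤n
  ... | no  c≮l = s≤s (interval<length ls (c ∸ l) (<+⇒∸< (≮⇒≥ c≮l) c<sum))

  interior : List ℕ → ℕ → List ℕ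
  interior []       _       = []
  interior (l ∷ ls) zero    = map (k ∸ 1 +_) (upTo (l ∸ (k ∸ 1)))
  interior (l ∷ ls) (suc j) = map (l +_) (interior ls j)

  ∈-interior : ∀ ls c → c < sum ls → OffLines ls c → c ∈ interior ls (interval ls c)
  ∈-interior (l ∷ ls) c c<sum offc with c <? l
  ... | yes c<l =
    subst (_∈ interior (l ∷ ls) 0) (m+[n∸m]≡n k-1≤c) (∈-map⁺ (k ∸ 1 +_) (∈-upTo⁺ (∸-monoˡ-< c<l k-1≤c)))
    where
    k-1≤c : k ∸ 1 ≤ c
    k-1≤c = ≮⇒≥ λ c<k-1 → offc (inj₁ (z≤n , c<k-1))
  ... | no  c≮l = subst (_∈ map (l +_) (interior ls (interval ls (c ∸ l)))) (m+[n∸m]≡n l≤c)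
                    (∈-map⁺ (l +_) (∈-interior ls (c ∸ l) (<+⇒∸< l≤c c<sum) (offLines-∷⁻ l ls c l≤c offc)))
    where
    l≤c = ≮⇒≥ c≮l

  length-interior : ∀ w ls → All (_≤ suc w) ls → 2 ≤ k → ∀ j → length (interior ls j) ≤ w
  length-interior w []       _              _   _       = z≤n
  length-interior w (l ∷ ls) (l≤1+w ∷ _)    2≤k zero    =
    subst (_≤ w) (sym (trans (length-map (k ∸ 1 +_) (upTo (l ∸ (k ∸ 1)))) (length-upTo (l ∸ (k ∸ 1)))))
      (∸-mono l≤1+w (∸-monoˡ-≤ 1 2≤k))
  length-interior w (l ∷ ls) (_ ∷ ls≤1+w) 2≤k (suc j) =
    subst (_≤ w) (sym (length-map (l +_) (interior ls j))) (length-interior w ls ls≤1+w 2≤k j)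

-- Blocks are boxes

module GridBlocks (k n : ℕ) (ls : List ℕ) (k≤ls : All (k ≤_) ls) (sum≡n : sum ls ≡ n) (2≤k : 2 ≤ k) where

  open Lines k

  coord : ∀ {d} → Pos n d → Fin d → ℕ
  coord x i = toℕ (lookup x i)

  coord<sum : ∀ {d} (x : Pos n d) i → coord x i < sum ls
  coord<sum x i = subst (coord x i <_) (sym sum≡n) (toℕ<n (lookup x i))

  OffGrid : ∀ {d} → Pos n d → Set
  OffGrid x = ∀ i → OffLines ls (coord x i)

  ¬Grid⇒OffGrid : ∀ {d} (x : Pos n d) → ¬ Grid k ls x → OffGrid x
  ¬Grid⇒OffGrid x ¬grid i online = ¬grid (i , online)

  OffGrid⇒¬Grid : ∀ {d} (x : Pos n d) → OffGrid x → ¬ Grid k ls x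
  OffGrid⇒¬Grid x off (i , online) = off i online

  InBox : ∀ {d} → Pos n d → Pos n d → Set
  InBox r x = ∀ i → OffLines ls (coord x i) × interval ls (coord x i) ≡ interval ls (coord r i)

  interval-close : ∀ a b → a < sum ls → b < sum ls → ∣ a - b ∣ < k →
                   OffLines ls a → OffLines ls b → interval ls a ≡ interval ls b
  interval-close a b a<sum b<sum ∣a-b∣<k offa offb with ≤-total a b
  ... | inj₁ a≤b = interval-near ls a b a≤b (∣-∣<⇒≤+ a≤b ∣a-b∣<k) b<sum offa offb
  ... | inj₂ b≤a =
    sym (interval-near ls b a b≤a (∣-∣<⇒≤+ b≤a (subst (_< k) (∣-∣-comm a b) ∣a-b∣<k)) a<sum offb offa)

  inBox-step : ∀ {d} {r y z : Pos n d} → InBox r y → Step (Grid k ls) y z → InBox r z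
  inBox-step {y = y} {z} y∈box (_ , ¬gridz , adj) i =
    offz , trans (sym (interval-close (coord y i) (coord z i) (coord<sum y i) (coord<sum z i) close (proj₁ (y∈box i)) offz))
                 (proj₂ (y∈box i))
    where
    offz = ¬Grid⇒OffGrid z ¬gridz i
    close : ∣ coord y i - coord z i ∣ < k
    close = ≤-trans (s≤s (subst (∣ coord y i - coord z i ∣ ≤_) adj (∣-∣≤ℓ₁ y z i))) 2≤k

  inBox-star : ∀ {d} {r y z : Pos n d} → InBox r y → Star (Step (Grid k ls)) y z → InBox r z
  inBox-star y∈box ε = y∈box
  inBox-star {r = r} y∈box (_◅_ {i = y} {j = y′} s path) =
    inBox-star {r = r} (inBox-step {r = r} {y} {y′} y∈box s) path

  Block⇒InBox : ∀ {d} {r x : Pos n d} → Block (Grid k ls) r x → InBox r x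
  Block⇒InBox {r = r} {x} (¬gridr , path) = inBox-star {r = r} (λ i → ¬Grid⇒OffGrid r ¬gridr i , refl) path

  -- A record rather than a product, so that its endpoints can be inferred.
  record OffStep {d} (x y : Pos n d) : Set where
    constructor offStep
    field
      offx : OffGrid x
      offy : OffGrid y
      adj  : Adj x y

  offStep-sym : ∀ {d} {x y : Pos n d} → OffStep x y → OffStep y x
  offStep-sym {x = x} {y} (offStep offx offy adj) = offStep offy offx (Adj-sym x y adj)

  offGrid-∷ : ∀ {d} {h : Fin n} {t : Pos n d} → OffLines ls (toℕ h) → OffGrid t → OffGrid (h ∷ t)
  offGrid-∷ offh offt fzero    = offh
  offGrid-∷ offh offt (fsuc i) = offt i

  offPath-∷ : ∀ {d} {h : Fin n} → OffLines ls (toℕ h) → {x y : Pos n d} →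
              Star OffStep x y → Star OffStep (h ∷ x) (h ∷ y)
  offPath-∷ {h = h} offh = gmap (h ∷_) λ {x} {y} (offStep offx offy adj) →
    offStep (offGrid-∷ {t = x} offh offx) (offGrid-∷ {t = y} offh offy) (Adj-∷ h x y adj)

  slide : ∀ {d} (t : Pos n d) → OffGrid t → ∀ m (a b : Fin n) → toℕ b ≡ m + toℕ a →
          (∀ c → toℕ a ≤ c → c ≤ toℕ b → OffLines ls c) → Star OffStep (a ∷ t) (b ∷ t)
  slide t offt zero    a b b≡a off = subst (λ z → Star OffStep (a ∷ t) (z ∷ t)) (sym (toℕ-injective b≡a)) ε
  slide t offt (suc m) a b b≡1+m+a off =
    slide t offt m a b′ b′≡m+a (λ c a≤c c≤b′ → off c a≤c (≤-trans c≤b′ b′≤b)) ◅◅ (last ◅ ε)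
    where
    m+a<n : m + toℕ a < n
    m+a<n = <⇒≤ (subst (_< n) b≡1+m+a (toℕ<n b))
    b′ = fromℕ< m+a<n
    b′≡m+a : toℕ b′ ≡ m + toℕ a
    b′≡m+a = toℕ-fromℕ< m+a<n
    b′≤b : toℕ b′ ≤ toℕ b
    b′≤b = subst₂ _≤_ (sym b′≡m+a) (sym b≡1+m+a) (n≤1+n _)
    last : OffStep (b′ ∷ t) (b ∷ t)
    last = offStep (offGrid-∷ (off (toℕ b′) (subst (toℕ a ≤_) (sym b′≡m+a) (m≤n+m _ m)) b′≤b) offt)
                   (offGrid-∷ (off (toℕ b) (≤-trans (m≤n+m _ m) (subst (m + toℕ a ≤_) (sym b≡1+m+a) (n≤1+n _))) ≤-refl) offt)
                   (Adj-suc t (trans b≡1+m+a (cong suc (sym b′≡m+a))))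

  slide-within-interval : ∀ {d} (t : Pos n d) → OffGrid t → (a b : Fin n) → OffLines ls (toℕ a) → OffLines ls (toℕ b) →
                          interval ls (toℕ a) ≡ interval ls (toℕ b) → Star OffStep (a ∷ t) (b ∷ t)
  slide-within-interval t offt a b offa offb same with ≤-total (toℕ a) (toℕ b)
  ... | inj₁ a≤b = slide t offt (toℕ b ∸ toℕ a) a b (sym (m∸n+n≡m a≤b))
                     λ c a≤c c≤b → proj₁ (interval-convex ls k≤ls (toℕ a) c (toℕ b) a≤c c≤b offa offb same)
  ... | inj₂ b≤a = reverse offStep-sym (slide t offt (toℕ a ∸ toℕ b) b a (sym (m∸n+n≡m b≤a))
                     λ c b≤c c≤a → proj₁ (interval-convex ls k≤ls (toℕ b) c (toℕ a) b≤c c≤a offb offa (sym same)))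

  offPath : ∀ {d} (r x : Pos n d) → OffGrid r → InBox r x → Star OffStep r x
  offPath []      []      _    _      = ε
  offPath (a ∷ r) (b ∷ x) offr x∈box =
    slide-within-interval r (λ i → offr (fsuc i)) a b (offr fzero) (proj₁ (x∈box fzero)) (sym (proj₂ (x∈box fzero)))
    ◅◅ offPath-∷ (proj₁ (x∈box fzero)) (offPath r x (λ i → offr (fsuc i)) (λ i → x∈box (fsuc i)))

  InBox⇒Block : ∀ {d} {r x : Pos n d} → ¬ Grid k ls r → InBox r x → Block (Grid k ls) r x
  InBox⇒Block {r = r} {x} ¬gridr x∈box =
    ¬gridr , gmap id (λ {y} {z} (offStep offy offz adj) → OffGrid⇒¬Grid y offy , OffGrid⇒¬Grid z offz , adj)
                     (offPath r x (¬Grid⇒OffGrid r ¬gridr) x∈box)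

  offGrid-in-window : ∀ {d} (a : Vec ℕ d) → (∀ i → lookup a i + k ≤ n) →
                      Σ (Pos n d) λ x → ¬ Grid k ls x × (∀ i → lookup a i ≤ coord x i × coord x i < lookup a i + k)
  offGrid-in-window a fits =
    x , OffGrid⇒¬Grid x offx ,
    λ i → subst (lookup a i ≤_) (sym (coord-x i)) (proj₁ (proj₂ (window i))) ,
          subst (_< lookup a i + k) (sym (coord-x i)) (proj₁ (proj₂ (proj₂ (window i))))
    where
    window : ∀ i → Σ ℕ λ c → lookup a i ≤ c × c < lookup a i + k × OffLines ls c
    window i = offLines-in-window ls k≤ls (≤-trans (s≤s z≤n) 2≤k) (lookup a i)
                 (subst (lookup a i + k ≤_) (sym sum≡n) (fits i))
    x = tabulate λ i → fromℕ< (<-≤-trans (proj₁ (proj₂ (proj₂ (window i)))) (fits i))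
    coord-x : ∀ i → coord x i ≡ proj₁ (window i)
    coord-x i = trans (cong toℕ (lookup∘tabulate _ i)) (toℕ-fromℕ< _)
    offx : OffGrid x
    offx i = subst (OffLines ls) (sym (coord-x i)) (proj₂ (proj₂ (proj₂ (window i))))

-- Deciding copies and repairability

module _ {n d k : ℕ} {Σ′ : Set} (F : List (Array k d Σ′)) where

  HasCopyIn-transport : ∀ {B B′ : Array n d Σ′} {X Y : Pos n d → Set} →
                        (∀ x → X x → B x ≡ B′ x) → (∀ x → X x → Y x) → HasCopyIn F B X → HasCopyIn F B′ Y
  HasCopyIn-transport B≡B′ X⊆Y (a , fits , S , S≡B , S∈F , inX) =
    a , fits , S , (λ j x sh → trans (S≡B j x sh) (B≡B′ x (inX j x sh))) , S∈F , (λ j x sh → X⊆Y x (inX j x sh))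

module Copies {n d k s : ℕ} (F : List (Array k d (Fin s))) (1≤k : 1 ≤ k) where

  Fits : Vec ℕ d → Set
  Fits a = ∀ i → lookup a i + k ≤ n

  -- The fitting proof is irrelevant, so shifts built from different proofs agree definitionally.
  shift : (a : Vec ℕ d) → .(Fits a) → Pos k d → Pos n d
  shift a fits j = tabulate λ i → fromℕ< (<-≤-trans (+-monoʳ-< (lookup a i) (toℕ<n (lookup j i))) (fits i))

  shift-isShift : ∀ a (fits : Fits a) j → IsShift a j (shift a fits j)
  shift-isShift a fits j i = trans (cong toℕ (lookup∘tabulate _ i)) (toℕ-fromℕ< _)

  isShift-unique : ∀ a (j : Pos k d) {x y : Pos n d} → IsShift a j x → IsShift a j y → x ≡ y
  isShift-unique a j x≡a+j y≡a+j = lookup-ext λ i → toℕ-injective (trans (x≡a+j i) (sym (y≡a+j i)))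

  CopyAt : Array n d (Fin s) → (Pos n d → Set) → Vec ℕ d → Set
  CopyAt B X a = Σ (Fits a) λ fits → (λ j → B (shift a fits j)) ∈F F × (∀ j → X (shift a fits j))

  ∈F? : (S : Array k d (Fin s)) → Dec (S ∈F F)
  ∈F? S = Any.any? (λ P → allVec? λ j → S j ≟ᶠ P j) F

  copyAt? : ∀ B {X} → (∀ x → Dec (X x)) → ∀ a → Dec (CopyAt B X a)
  copyAt? B X? a with all? (λ i → lookup a i + k ≤? n)
  ... | no ¬fits = no λ (fits , _) → ¬fits fits
  ... | yes fits = map′ (λ (S∈F , inX) → fits , S∈F , inX) (λ (_ , S∈F , inX) → S∈F , inX)
                        (∈F? (λ j → B (shift a fits j)) ×-dec allVec? (λ j → X? (shift a fits j)))

  CopyAt⇒HasCopyIn : ∀ {B X a} → CopyAt B X a → HasCopyIn F B X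
  CopyAt⇒HasCopyIn {B} {X} {a} (fits , S∈F , inX) =
    a , fits , (λ j → B (shift a fits j)) ,
    (λ j x sh → cong B (isShift-unique a j (shift-isShift a fits j) sh)) , S∈F ,
    (λ j x sh → subst X (isShift-unique a j (shift-isShift a fits j) sh) (inX j))

  HasCopyIn⇒CopyAt : ∀ {B X} → (c : HasCopyIn F B X) → CopyAt B X (proj₁ c)
  HasCopyIn⇒CopyAt (a , fits , S , S≡B , S∈F , inX) =
    fits ,
    Any.map (λ S≈P j → trans (sym (S≡B j _ (shift-isShift a fits j))) (S≈P j)) S∈F ,
    (λ j → inX j _ (shift-isShift a fits j))

  toFins : (a : Vec ℕ d) → Fits a → Vec (Fin n) d
  toFins a fits = tabulate λ i → fromℕ< (<-≤-trans (m<m+n (lookup a i) 1≤k) (fits i))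

  map-toℕ-toFins : ∀ a (fits : Fits a) → Vec.map toℕ (toFins a fits) ≡ a
  map-toℕ-toFins a fits = lookup-ext λ i →
    trans (lookup-map i toℕ (toFins a fits)) (trans (cong toℕ (lookup∘tabulate _ i)) (toℕ-fromℕ< _))

  hasCopyIn? : ∀ B {X} → (∀ x → Dec (X x)) → Dec (HasCopyIn F B X)
  hasCopyIn? B {X} X? =
    map′ (λ (o , c) → CopyAt⇒HasCopyIn {a = Vec.map toℕ o} c) found (anyVec? λ o → copyAt? B X? (Vec.map toℕ o))
    where
    found : HasCopyIn F B X → ∃ λ o → CopyAt B X (Vec.map toℕ o)
    found c@(a , fits , _) = toFins a fits , subst (CopyAt B X) (sym (map-toℕ-toFins a fits)) (HasCopyIn⇒CopyAt c)

module _ {n d s : ℕ} where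

  positions : List (Pos n d)
  positions = choices (replicate d (List.allFin n))

  ∈-positions : (x : Pos n d) → x ∈ positions
  ∈-positions x = ∈-choices (replicate d (allFin n)) λ i →
    subst (lookup x i ∈_) (sym (lookup-replicate i (allFin n))) (∈-allFin _)

  -- Arrays are tabulated along an enumeration of [n]^d, so that repairs can be searched exhaustively.
  Table : Set
  Table = Vec (Fin s) (length positions)

  fromTable : Table → Array n d (Fin s)
  fromTable t x = lookup t (Any.index (∈-positions x))

  toTable : Array n d (Fin s) → Table
  toTable B = tabulate λ i → B (List.lookup positions i)

  fromTable-toTable : ∀ B x → fromTable (toTable B) x ≡ B x
  fromTable-toTable B x =
    trans (lookup∘tabulate (λ i → B (List.lookup positions i)) _) (cong B (sym (lookup-index (∈-positions x))))

module _ {n d : ℕ} {Al : Set} {X : Pos n d → Set} (X? : ∀ x → Dec (X x)) where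

  overwrite : Array n d Al → Array n d Al → Array n d Al
  overwrite B′ B x with X? x
  ... | yes _ = B′ x
  ... | no  _ = B x

  overwrite-out : ∀ B′ B {x} → ¬ X x → overwrite B′ B x ≡ B x
  overwrite-out B′ B {x} ¬Xx with X? x
  ... | yes Xx = contradiction Xx ¬Xx
  ... | no  _  = refl

-- The witness-carrying, constructive complement of Unrepairable.
Repairable : ∀ {n k d Al} → List (Array k d Al) → Array n d Al → (Pos n d → Set) → Set
Repairable {n} {k} {d} {Al} F A B =
  Σ (Array n d Al) λ A′ → (∀ x → Boundary k B x → A′ x ≡ A x) × ¬ HasCopyIn F A′ (Closure k B)

module _ {n d k s : ℕ} (F : List (Array k d (Fin s))) (A : Array n d (Fin s)) (1≤k : 1 ≤ k)
         {B : Pos n d → Set} (B? : ∀ x → Dec (B x)) where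

  open Copies {n = n} F 1≤k

  closure? : ∀ x → Dec (Closure k B x)
  closure? x = anyVec? λ y → B? y ×-dec all? λ i → ∣ toℕ (lookup x i) - toℕ (lookup y i) ∣ <? k

  repairable⊎unrepairable : Repairable F A B ⊎ Unrepairable F A B
  repairable⊎unrepairable with anyVec? (λ t → ¬? (hasCopyIn? (overwrite B? (fromTable t) A) closure?))
  ... | yes (t , noCopy) = inj₁ (overwrite B? (fromTable t) A , (λ x (_ , ¬Bx) → overwrite-out B? _ A ¬Bx) , noCopy)
  ... | no  ¬repair      = inj₂ λ A′ A′≡A →
    let patched = overwrite B? (fromTable (toTable A′)) A
        copy    = decidable-stable (hasCopyIn? patched closure?) (λ noCopy → ¬repair (toTable A′ , noCopy))
    in HasCopyIn-transport F (patched≡A′ A′ A′≡A) (λ _ inC → inC) copy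
    where
    patched≡A′ : ∀ A′ → (∀ x → Boundary k B x → A′ x ≡ A x) →
                 ∀ x → Closure k B x → overwrite B? (fromTable (toTable A′)) A x ≡ A′ x
    patched≡A′ A′ A′≡A x inC with B? x
    ... | yes _  = fromTable-toTable A′ x
    ... | no ¬Bx = sym (A′≡A x (inC , ¬Bx))

  unrepairable? : Dec (Unrepairable F A B)
  unrepairable? with repairable⊎unrepairable
  ... | inj₁ (A′ , keepsBoundary , noCopy) = no λ unrep → noCopy (unrep A′ keepsBoundary)
  ... | inj₂ unrep                         = yes unrep

-- Gluing repairs of the dirty blocks

module Representatives (k n : ℕ) (ls : List ℕ) (k≤ls : All (k ≤_) ls) (sum≡n : sum ls ≡ n) (2≤k : 2 ≤ k)
                       {d : ℕ} (R : List (Pos n d)) (reps : BlockReps (Grid k ls) R) where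

  open Lines k
  open GridBlocks k n ls k≤ls sum≡n 2≤k

  G : Pos n d → Set
  G = Grid k ls

  offLines? : ∀ c → Dec (OffLines ls c)
  offLines? c = ¬? (inLines? ls 0 c)

  block? : ∀ r x → Dec (Block G r x)
  block? r x with all? (λ i → offLines? (coord r i))
  ... | no  ¬offr = no λ (¬gridr , _) → ¬offr (¬Grid⇒OffGrid r ¬gridr)
  ... | yes offr  = map′ (InBox⇒Block (OffGrid⇒¬Grid r offr)) (Block⇒InBox {r = r})
                         (all? λ i → offLines? (coord x i) ×-dec (interval ls (coord x i) ≟ interval ls (coord r i)))

  same-intervals⇒Block : ∀ {r x} → ¬ G r → ¬ G x →
                         (∀ i → interval ls (coord x i) ≡ interval ls (coord r i)) → Block G r x
  same-intervals⇒Block {r} {x} ¬gridr ¬gridx same = InBox⇒Block ¬gridr λ i → ¬Grid⇒OffGrid x ¬gridx i , same i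

  Block⇒same-intervals : ∀ {r x} → Block G r x → ∀ i → interval ls (coord x i) ≡ interval ls (coord r i)
  Block⇒same-intervals {r} blk i = proj₂ (Block⇒InBox {r = r} blk i)

  Block-sym : ∀ {r x} → Block G r x → Block G x r
  Block-sym {r} {x} blk = same-intervals⇒Block (OffGrid⇒¬Grid x λ i → proj₁ (Block⇒InBox {r = r} blk i)) (proj₁ blk)
                                              (λ i → sym (Block⇒same-intervals blk i))

  rep-offGrid : ∀ {r} → r ∈ R → ¬ G r
  rep-offGrid = All.lookup (proj₁ reps)

  rep-unique : ∀ {r r′} → r ∈ R → r′ ∈ R → Block G r r′ → r ≡ r′
  rep-unique = unique (proj₂ (proj₂ reps))
    where
    unique : ∀ {rs : List (Pos n d)} {r r′} → AllPairs (λ r r′ → ¬ Block G r r′) rs →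
             r ∈ rs → r′ ∈ rs → Block G r r′ → r ≡ r′
    unique (_ ∷ _)     (here refl) (here refl) _   = refl
    unique (apart ∷ _) (here refl) (there r′∈) blk = contradiction blk (All.lookup apart r′∈)
    unique (apart ∷ _) (there r∈)  (here refl) blk = contradiction (Block-sym blk) (All.lookup apart r∈)
    unique (_ ∷ pairs) (there r∈)  (there r′∈) blk = unique pairs r∈ r′∈ blk

  intervalVector : Pos n d → Vec (Fin (length ls)) d
  intervalVector x = tabulate λ i → fromℕ< (interval<length ls (coord x i) (coord<sum x i))

  toℕ-intervalVector : ∀ x i → toℕ (lookup (intervalVector x) i) ≡ interval ls (coord x i)
  toℕ-intervalVector x i = trans (cong toℕ (lookup∘tabulate _ i)) (toℕ-fromℕ< _)

  reps-length≤ : length R ≤ length ls ^ d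
  reps-length≤ = AllPairs-length≤ (encode ∘ intervalVector) collision (proj₂ (proj₂ reps))
    where
    collision : ∀ {r r′} → r ∈ R → r′ ∈ R →
                encode (intervalVector r) ≡ encode (intervalVector r′) → ¬ ¬ Block G r r′
    collision {r} {r′} r∈ r′∈ same ¬blk = ¬blk (same-intervals⇒Block (rep-offGrid r∈) (rep-offGrid r′∈) λ i →
      let same-i = cong (λ v → toℕ (lookup v i)) (encode-injective (intervalVector r) (intervalVector r′) same)
      in trans (sym (toℕ-intervalVector r′ i)) (trans (sym same-i) (toℕ-intervalVector r i)))

  intervalInterior : Fin n → List (Fin n)
  intervalInterior c = finsBelow n (interior ls (interval ls (toℕ c)))

  box : Pos n d → List (Pos n d)
  box r = choices (Vec.map intervalInterior r)

  Block⊆box : ∀ {r x} → Block G r x → x ∈ box r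
  Block⊆box {r} {x} blk = ∈-choices (Vec.map intervalInterior r) λ i →
    subst (lookup x i ∈_) (sym (lookup-map i intervalInterior r))
      (∈-finsBelow (interior ls (interval ls (coord r i)))
        (subst (λ j → coord x i ∈ interior ls j) (Block⇒same-intervals blk i)
          (∈-interior ls (coord x i) (coord<sum x i) (proj₁ (Block⇒InBox {r = r} blk i)))))

  length-box≤ : ∀ {w} → All (_≤ suc w) ls → ∀ r → length (box r) ≤ w ^ d
  length-box≤ {w} ls≤1+w r = length-choices≤ w (Vec.map intervalInterior r) λ i →
    subst (λ xs → length xs ≤ w) (sym (lookup-map i intervalInterior r))
      (≤-trans (length-finsBelow n (interior ls (interval ls (coord r i))))
               (length-interior w ls ls≤1+w 2≤k (interval ls (coord r i))))

  module Repairing {s : ℕ} (F : List (Array k d (Fin s))) (A : Array n d (Fin s))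
                   (noUnrep : ¬ Any (λ r → Unrepairable F A (Block G r)) R) where

    1≤k : 1 ≤ k
    1≤k = ≤-trans (s≤s z≤n) 2≤k

    open Copies {n = n} F 1≤k using (hasCopyIn?)

    C : Pos n d → Pos n d → Set
    C r = Closure k (Block G r)

    Dirty : Pos n d → Set
    Dirty r = HasCopyIn F A (C r)

    dirty? : ∀ r → Dec (Dirty r)
    dirty? r = hasCopyIn? A (closure? F A 1≤k (block? r))

    -- Only dirty blocks are rewritten, so the glued array differs from A only inside dirty blocks.
    repaired : Pos n d → Array n d (Fin s)
    repaired r with repairable⊎unrepairable F A 1≤k (block? r) | dirty? r
    ... | inj₁ (A′ , _) | yes _ = A′
    ... | _             | _     = A

    repaired-noCopy : ∀ {r} → r ∈ R → ¬ HasCopyIn F (repaired r) (C r)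
    repaired-noCopy {r} r∈R with repairable⊎unrepairable F A 1≤k (block? r) | dirty? r
    ... | inj₁ (_ , _ , noCopy) | yes _ = noCopy
    ... | inj₁ _                | no clean = clean
    ... | inj₂ unrep            | _     = contradiction (lose r∈R unrep) noUnrep

    repaired-boundary : ∀ {r y} → C r y → ¬ Block G r y → repaired r y ≡ A y
    repaired-boundary {r} {y} inC ¬blk with repairable⊎unrepairable F A 1≤k (block? r) | dirty? r
    ... | inj₁ (_ , keepsBoundary , _) | yes _ = keepsBoundary y (inC , ¬blk)
    ... | inj₁ _                       | no _  = refl
    ... | inj₂ _                       | _     = refl

    repaired-dirty : ∀ r x → A x ≡ repaired r x ⊎ Dirty r
    repaired-dirty r x with repairable⊎unrepairable F A 1≤k (block? r) | dirty? r
    ... | inj₁ _ | yes dirty = inj₂ dirty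
    ... | inj₁ _ | no _      = inj₁ refl
    ... | inj₂ _ | _         = inj₁ refl

    repairedAt : ∀ x → Dec (Any (λ r → Block G r x) R) → Fin s
    repairedAt x (yes inBlock) = repaired (proj₁ (find inBlock)) x
    repairedAt x (no _)        = A x

    A′ : Array n d (Fin s)
    A′ x = repairedAt x (Any.any? (λ r → block? r x) R)

    A′≡repaired : ∀ {r₀ x₀ y} → r₀ ∈ R → Block G r₀ x₀ → (∀ i → ∣ coord y i - coord x₀ i ∣ < k) →
                  A′ y ≡ repaired r₀ y
    A′≡repaired {r₀} {x₀} {y} r₀∈R blk₀ close = agree (Any.any? (λ r → block? r y) R)
      where
      agree : (inBlock? : Dec (Any (λ r → Block G r y) R)) → repairedAt y inBlock? ≡ repaired r₀ y
      agree (no ∉blocks)  = sym (repaired-boundary {r₀} (x₀ , blk₀ , close) λ blk → ∉blocks (lose r₀∈R blk))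
      agree (yes inBlock) with find inBlock
      ... | r , r∈R , blk = cong (λ r → repaired r y) (sym (rep-unique r₀∈R r∈R r₀~r))
        where
        r₀~r : Block G r₀ r
        r₀~r = same-intervals⇒Block (rep-offGrid r₀∈R) (rep-offGrid r∈R) λ i →
          trans (sym (Block⇒same-intervals blk i))
            (trans (interval-close (coord y i) (coord x₀ i) (coord<sum y i) (coord<sum x₀ i) (close i)
                      (proj₁ (Block⇒InBox {r = r} blk i)) (proj₁ (Block⇒InBox {r = r₀} blk₀ i)))
                   (Block⇒same-intervals blk₀ i))

    -- A window contains an off-grid point x₀, hence lies in the closure of x₀'s block, where A′
    -- agrees with that block's repair.
    A′-satisfies : Satisfies F A′
    A′-satisfies (a , fits , S , S≡A′ , S∈F , _) with offGrid-in-window a fits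
    ... | x₀ , ¬gridx₀ , x₀∈window with find (proj₁ (proj₂ reps) x₀ ¬gridx₀)
    ...   | r₀ , r₀∈R , blk₀ =
      repaired-noCopy r₀∈R (a , fits , S , S≡repaired , S∈F , λ j y sh → x₀ , blk₀ , close j y sh)
      where
      close : ∀ (j : Pos k d) y → IsShift a j y → ∀ i → ∣ coord y i - coord x₀ i ∣ < k
      close j y y≡a+j i =
        ∣-∣<-window (subst (lookup a i ≤_) (sym (y≡a+j i)) (m≤m+n _ _))
                    (subst (_< lookup a i + k) (sym (y≡a+j i)) (+-monoʳ-< (lookup a i) (toℕ<n (lookup j i))))
                    (proj₁ (x₀∈window i)) (proj₂ (x₀∈window i))
      S≡repaired : SubarrayAt (repaired r₀) a S
      S≡repaired j y sh = trans (S≡A′ j y sh) (A′≡repaired r₀∈R blk₀ (close j y sh))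

    dirtyReps : List (Pos n d)
    dirtyReps = filter dirty? R

    A′-differs : ∀ x → A x ≡ A′ x ⊎ x ∈ concatMap box dirtyReps
    A′-differs x with Any.any? (λ r → block? r x) R
    ... | no _        = inj₁ refl
    ... | yes inBlock with find inBlock
    ...   | r , r∈R , blk with repaired-dirty r x
    ...     | inj₁ unchanged = inj₁ unchanged
    ...     | inj₂ dirty     = inj₂ (∈-concat⁺′ (Block⊆box blk) (∈-map⁺ box (∈-filter⁺ dirty? r∈R dirty)))

    dirtyReps-fraction : ∀ {p q w} → Far F A p q → k ≤ w → All (w ≤_) ls → All (_≤ suc w) ls →
                         p * length R ≤ q * length dirtyReps
    dirtyReps-fraction {p} {q} {w} far k≤w w≤ls ls≤1+w =
      *-cancelʳ-≤ (p * length R) (q * length dirtyReps) (w ^ d) {{m^n≢0 w d {{>-nonZero (≤-trans 1≤k k≤w)}}}}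
      (begin
        p * length R * w ^ d                   ≡⟨ *-assoc p (length R) (w ^ d) ⟩
        p * (length R * w ^ d)                 ≤⟨ *-monoʳ-≤ p (*-monoˡ-≤ (w ^ d) reps-length≤) ⟩
        p * (length ls ^ d * w ^ d)            ≡⟨ cong (p *_) (^-distribʳ-* (length ls) w d) ⟨
        p * (length ls * w) ^ d                ≤⟨ *-monoʳ-≤ p (^-monoˡ-≤ d tw≤n) ⟩
        p * n ^ d                              ≤⟨ far A′ A′-satisfies (concatMap box dirtyReps) A′-differs ⟩
        q * length (concatMap box dirtyReps)   ≤⟨ *-monoʳ-≤ q (length-concatMap≤ box (length-box≤ ls≤1+w) dirtyReps) ⟩
        q * (length dirtyReps * w ^ d)         ≡⟨ *-assoc q (length dirtyReps) (w ^ d) ⟨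
        q * length dirtyReps * w ^ d           ∎)
      where
      open ≤-Reasoning
      tw≤n : length ls * w ≤ n
      tw≤n = subst (length ls * w ≤_) sum≡n (length*≤sum w ls w≤ls)

module Dichotomy {n d k w s : ℕ} (F : List (Array k d (Fin s))) (A : Array n d (Fin s)) {p q : ℕ}
                 (far : Far F A p q) (2≤k : 2 ≤ k) (k≤w : k ≤ w)
                 (ls : List ℕ) (lengths : All (λ l → l ≡ w ⊎ l ≡ suc w) ls) (sum≡n : sum ls ≡ n)
                 (R : List (Pos n d)) (reps : BlockReps (Grid k ls) R) where

  w≤ls : All (w ≤_) ls
  w≤ls = All.map (λ { (inj₁ refl) → ≤-refl ; (inj₂ refl) → n≤1+n w }) lengths

  ls≤1+w : All (_≤ suc w) ls
  ls≤1+w = All.map (λ { (inj₁ refl) → n≤1+n w ; (inj₂ refl) → ≤-refl }) lengths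

  open Representatives k n ls (All.map (≤-trans k≤w) w≤ls) sum≡n 2≤k R reps

  unrepairable⊎dirtyFraction :
    (∃[ r ] (r ∈ R × Unrepairable F A (Block G r)))
    ⊎ (Σ (List (Pos n d)) λ R′ → R′ ⊆ R × All (λ r → HasCopyIn F A (Closure k (Block G r))) R′
        × p * length R ≤ q * length R′)
  unrepairable⊎dirtyFraction with Any.any? (λ r → unrepairable? F A (≤-trans (s≤s z≤n) 2≤k) (block? r)) R
  ... | yes unrepairableRep = inj₁ (find unrepairableRep)
  ... | no  allRepairable   =
    inj₂ (dirtyReps , filter-⊆ dirty? R , all-filter dirty? R , dirtyReps-fraction {p} {q} far k≤w w≤ls ls≤1+w)
    where open Repairing F A allRepairable

lemma3 : (n d k w s : ℕ) (F : List (Array k d (Fin s))) (A : Array n d (Fin s))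
    (p q : ℕ) → .{{_ : NonZero q}} → Far F A p q →
    2 ≤ k → k ≤ w → (ls : List ℕ) → IsIntervalPartition n w ls →
    (R : List (Pos n d)) → BlockReps (Grid k ls) R →
    (∃[ r ] (r ∈ R × Unrepairable F A (Block (Grid k ls) r)))
    ⊎ (Σ (List (Pos n d)) λ R' → R' ⊆ R × All (λ r → HasCopyIn F A (Closure k (Block (Grid k ls) r))) R'
        × p * length R ≤ q * length R')
lemma3 n d k w s F A p q far 2≤k k≤w ls (lengths , sum≡n) R reps =
  Dichotomy.unrepairable⊎dirtyFraction F A {p} {q} far 2≤k k≤w ls lengths sum≡n R reps
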